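{- Let $(\mathscr{A},\preccurlyeq,\to)$ be an implicative structure. For each separator $S\subseteq\mathscr{A}$, the poset reflection $H:=(\mathscr{A}/S,\le_S)$ of the preordered set $(\mathscr{A},\vdash_S)$ is a Heyting algebra whose operations are given for all $a,b\in\mathscr{A}$ by: $[a]\to_H[b]=[a\to b]$, $[a]\land_H[b]=[a\times b]$, $[a]\lor_H[b]=[a+b]$, $\top_H=[\top]=S$, $\bot_H=[\bot]=\{c\in\mathscr{A}:(\lnot c)\in S\}$ (writing $[a]$ the equivalence class of $a$). If, moreover, the separator $S\subseteq\mathscr{A}$ is classical, then the induced Heyting algebra $H=(\mathscr{A}/S,\le_S)$ is a Boolean algebra.
   Context: An implicative structure is a complete lattice $(\mathscr{A},\preccurlyeq)$ (meets $\bigwedge$, top $\top$, bottom $\bot$) with $\to$ anti-monotonic in its first and monotonic in its second argument, commuting with arbitrary meets in its second argument. A separator is an upwards closed $S\subseteq\mathscr{A}$ containing $\bigwedge_{a,b}(a\to b\to a)$ and $\bigwedge_{a,b,c}((a\to b\to c)\to(a\to b)\to a\to c)$ and closed under modus ponens; it is classical if $\bigwedge_{a,b}(((a\to b)\to a)\to a)\in S$. The entailment is $a\vdash_S b$ iff $(a\to b)\in S$ (a preorder). Connectives: $\lnot a=a\to\bot$, $a\times b=\bigwedge_{c}((a\to b\to c)\to c)$, $a+b=\bigwedge_{c}((a\to c)\to(b\to c)\to c)$. -}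

module Defs where

open import Level using (Level; _⊔_; suc)
open import Data.Product using (_×_; _,_; Σ; ∃)
open import Relation.Binary.PropositionalEquality using (_≡_)
import Data.Empty.Polymorphic as Empty
open import Relation.Binary.Structures using (IsPartialOrder)

record ImplicativeStructure (ℓa ℓr : Level) : Set (suc (ℓa ⊔ ℓr)) where
  infixr 6 _⇒_
  infix 4 _≼_
  field
    Carrier : Set ℓa
    _≼_ : Carrier → Carrier → Set ℓr
    isPartialOrder : IsPartialOrder _≡_ _≼_
    ⋀ : {I : Set ℓa} → (I → Carrier) → Carrier
    ⋀-lower : {I : Set ℓa} (f : I → Carrier) (i : I) → ⋀ f ≼ f i
    ⋀-greatest : {I : Set ℓa} (f : I → Carrier) (c : Carrier) →
                 ((i : I) → c ≼ f i) → c ≼ ⋀ f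
    _⇒_ : Carrier → Carrier → Carrier
    ⇒-anti : ∀ {a a′ b} → a′ ≼ a → (a ⇒ b) ≼ (a′ ⇒ b)
    ⇒-mono : ∀ {a b b′} → b ≼ b′ → (a ⇒ b) ≼ (a ⇒ b′)
    ⇒-⋀ : ∀ (a : Carrier) {I : Set ℓa} (f : I → Carrier) →
          (a ⇒ ⋀ f) ≡ ⋀ (λ i → a ⇒ f i)

module ImplicativeStructureOps {ℓa ℓr : Level} (𝒜 : ImplicativeStructure ℓa ℓr) where
  open ImplicativeStructure 𝒜

  ⊤ : Carrier
  ⊤ = ⋀ {I = Empty.⊥ {ℓa}} (λ ())

  ⊥ : Carrier
  ⊥ = ⋀ {I = Carrier} (λ c → c)

  𝐊 : Carrier
  𝐊 = ⋀ {I = Carrier × Carrier} (λ { (x , y) → x ⇒ y ⇒ x })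

  𝐒 : Carrier
  𝐒 = ⋀ {I = Carrier × Carrier × Carrier}
        (λ { (x , y , z) → (x ⇒ y ⇒ z) ⇒ (x ⇒ y) ⇒ x ⇒ z })

  cc : Carrier
  cc = ⋀ {I = Carrier × Carrier} (λ { (x , y) → ((x ⇒ y) ⇒ x) ⇒ x })

  ¬′ : Carrier → Carrier
  ¬′ x = x ⇒ ⊥

  _⊗_ : Carrier → Carrier → Carrier
  x ⊗ y = ⋀ {I = Carrier} (λ c → (x ⇒ y ⇒ c) ⇒ c)

  _⊕_ : Carrier → Carrier → Carrier
  x ⊕ y = ⋀ {I = Carrier} (λ c → (x ⇒ c) ⇒ (y ⇒ c) ⇒ c)

  record IsSeparator {s : Level} (S : Carrier → Set s) : Set (ℓa ⊔ ℓr ⊔ s) where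
    field
      upward : ∀ {x y} → x ≼ y → S x → S y
      K∈S : S 𝐊
      S∈S : S 𝐒
      modusPonens : ∀ {x y} → S (x ⇒ y) → S x → S y

  IsClassical : {s : Level} → (S : Carrier → Set s) → Set s
  IsClassical S = S cc

  module Entailment {s : Level} (S : Carrier → Set s) where
    infix 4 _⊢_ _⊣⊢_
    _⊢_ : Carrier → Carrier → Set s
    x ⊢ y = S (x ⇒ y)

    _⊣⊢_ : Carrier → Carrier → Set s
    x ⊣⊢ y = (x ⊢ y) × (y ⊢ x)

module Submission where

-- A separator contains K and S and is closed under modus ponens, so it
-- validates a Hilbert-style calculus; by bracket abstraction this calculus
-- enjoys the deduction theorem, and entailments x ⊢ y can be established by
-- writing "λ-terms" in a context of hypotheses.  The connectives ⊗, ⊕ and the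
-- bottom ⊥ are impredicative meets over a "type variable" c, so we work with
-- families Carrier → Carrier: a derivation  Γ ⊩ b  says that the separator
-- contains the meet over c of the implication (Γ ⇒ b)(c), i.e. the derivation
-- is uniform in c.  Such a uniform derivation generalises to ⋀, which is how
-- the introduction rules of ⊗ and ⊕ are obtained; their elimination rules are
-- instantiations of the meet.

open import Defs
open import Level using (Level)
open import Data.Product using (_×_; _,_; proj₁)
open import Function.Base using (id)
open import Function.Bundles using (_⇔_; mk⇔)
open import Relation.Binary.PropositionalEquality using (subst; sym; cong)
open import Relation.Binary.Structures using (IsPartialOrder)
open import Relation.Binary.Lattice.Structures using (IsHeytingAlgebra; IsBooleanAlgebra; IsBoundedLattice)

module ImplicativeLogic {ℓa ℓr : Level} (𝒜 : ImplicativeStructure ℓa ℓr) where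
  open ImplicativeStructure 𝒜
  open ImplicativeStructureOps 𝒜

  ≼-refl : ∀ {x} → x ≼ x
  ≼-refl = IsPartialOrder.refl isPartialOrder

  ≼-trans : ∀ {x y z} → x ≼ y → y ≼ z → x ≼ z
  ≼-trans = IsPartialOrder.trans isPartialOrder

  ⋀-mono : {I : Set ℓa} {f g : I → Carrier} → (∀ i → f i ≼ g i) → ⋀ f ≼ ⋀ g
  ⋀-mono {f = f} {g} f≼g = ⋀-greatest g (⋀ f) (λ i → ≼-trans (⋀-lower f i) (f≼g i))

  -- A meet of implications lies below the implication between the meets;
  -- this is what lets modus ponens act on uniform families.
  ⋀-⇒ : {I : Set ℓa} (f g : I → Carrier) → ⋀ (λ i → f i ⇒ g i) ≼ (⋀ f ⇒ ⋀ g)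
  ⋀-⇒ f g = subst (⋀ (λ i → f i ⇒ g i) ≼_) (sym (⇒-⋀ (⋀ f) g))
                  (⋀-mono (λ i → ⇒-anti (⋀-lower f i)))

  ≼-⊤ : ∀ x → x ≼ ⊤
  ≼-⊤ x = ⋀-greatest _ x (λ ())

  -- Formulas with one free "type variable" c, and contexts of hypotheses.
  Family : Set ℓa
  Family = Carrier → Carrier

  infixr 6 _⟶_
  _⟶_ : Family → Family → Family
  (a ⟶ b) c = a c ⇒ b c

  ⟨_⟩ : Carrier → Family
  ⟨ x ⟩ _ = x

  ι : Family
  ι c = c

  infixl 5 _,,_
  data Context : Set ℓa where
    ε : Context
    _,,_ : Context → Family → Context

  infixr 4 _⟹_
  _⟹_ : Context → Family → Family
  ε ⟹ b = b
  (Γ ,, a) ⟹ b = Γ ⟹ (a ⟶ b)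

  ⟹-mono : (Γ : Context) {b b′ : Family} → (∀ c → b c ≼ b′ c) → ∀ c → (Γ ⟹ b) c ≼ (Γ ⟹ b′) c
  ⟹-mono ε b≼b′ = b≼b′
  ⟹-mono (Γ ,, a) b≼b′ = ⟹-mono Γ (λ c → ⇒-mono (b≼b′ c))

  module SeparatorLogic {s : Level} (S : Carrier → Set s) (sep : IsSeparator S) where
    open IsSeparator sep
    open Entailment S

    -- Γ ⊩ b : the separator realises b from the hypotheses Γ, uniformly in c.
    -- (A record, so that Γ and b can be inferred from the type.)
    infix 3 _⊩_
    record _⊩_ (Γ : Context) (b : Family) : Set s where
      constructor valid
      field realiser : S (⋀ (Γ ⟹ b))
    open _⊩_

    -- deduction theorem, definitionally: the last hypothesis is a premise
    ⟶-intro : ∀ {Γ a b} → Γ ,, a ⊩ b → Γ ⊩ a ⟶ b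
    ⟶-intro d = valid (realiser d)

    ⟶-intro⁻¹ : ∀ {Γ a b} → Γ ⊩ a ⟶ b → Γ ,, a ⊩ b
    ⟶-intro⁻¹ d = valid (realiser d)

    ⊩-mono : ∀ {Γ b b′} → (∀ c → b c ≼ b′ c) → Γ ⊩ b → Γ ⊩ b′
    ⊩-mono {Γ} b≼b′ d = valid (upward (⋀-mono (⟹-mono Γ b≼b′)) (realiser d))

    mp : ∀ {a b} → ε ⊩ a ⟶ b → ε ⊩ a → ε ⊩ b
    mp {a} {b} f x = valid (modusPonens (upward (⋀-⇒ a b) (realiser f)) (realiser x))

    K-valid : ∀ {a b} → ε ⊩ a ⟶ b ⟶ a
    K-valid {a} {b} = valid (upward (⋀-greatest _ 𝐊 (λ c → ⋀-lower _ (a c , b c))) K∈S)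

    S-valid : ∀ {a b e} → ε ⊩ (a ⟶ b ⟶ e) ⟶ (a ⟶ b) ⟶ a ⟶ e
    S-valid {a} {b} {e} = valid (upward (⋀-greatest _ 𝐒 (λ c → ⋀-lower _ (a c , b c , e c))) S∈S)

    -- Modus ponens and closed derivations in any context (bracket abstraction:
    -- under a hypothesis, application is mediated by S and constants by K).
    app : ∀ {Γ a b} → Γ ⊩ a ⟶ b → Γ ⊩ a → Γ ⊩ b
    closed : ∀ {Γ b} → ε ⊩ b → Γ ⊩ b
    app {ε} f x = mp f x
    app {Γ ,, _} f x = ⟶-intro⁻¹ (app (app (closed S-valid) (⟶-intro f)) (⟶-intro x))
    closed {ε} d = d
    closed {Γ ,, _} d = ⟶-intro⁻¹ (app (closed K-valid) (closed d))

    weaken : ∀ {Γ a b} → Γ ⊩ b → Γ ,, a ⊩ b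
    weaken d = ⟶-intro⁻¹ (app (closed K-valid) d)

    I-valid : ∀ {a} → ε ⊩ a ⟶ a
    I-valid {a} = mp (mp (S-valid {a} {a ⟶ a}) K-valid) K-valid

    hyp : ∀ {Γ a} → Γ ,, a ⊩ a
    hyp = ⟶-intro⁻¹ (closed I-valid)

    subsumption : ∀ {Γ a b} → (∀ c → a c ≼ b c) → Γ ⊩ a ⟶ b
    subsumption a≼b = closed (⊩-mono (λ c → ⇒-anti (a≼b c)) I-valid)

    lift : ∀ {Γ x} → S x → Γ ⊩ ⟨ x ⟩
    lift {x = x} sx = closed (valid (upward (⋀-greatest ⟨ x ⟩ x (λ _ → ≼-refl)) sx))

    lower : ∀ {x} → ε ⊩ ⟨ x ⟩ → S x
    lower {x} d = upward (⋀-lower ⟨ x ⟩ x) (realiser d)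

    generalise : ∀ {x f} → ε ,, ⟨ x ⟩ ⊩ f → x ⊢ ⋀ f
    generalise {x} {f} d = subst S (sym (⇒-⋀ x f)) (realiser d)

    entails : ∀ {x y} → ε ,, ⟨ x ⟩ ⊩ ⟨ y ⟩ → x ⊢ y
    entails d = lower (⟶-intro d)

    use : ∀ {Γ x y} → x ⊢ y → Γ ⊩ ⟨ x ⟩ → Γ ⊩ ⟨ y ⟩
    use x⊢y d = app (lift x⊢y) d

    -- ⊥ lies below every instance, hence proves any family
    ex-falso : ∀ {Γ a} → Γ ⊩ ⟨ ⊥ ⟩ → Γ ⊩ a
    ex-falso {a = a} d = app (subsumption (λ c → ⋀-lower id (a c))) d

    ⊢-refl : ∀ {x} → x ⊢ x
    ⊢-refl = entails hyp

    ⊢-trans : ∀ {x y z} → x ⊢ y → y ⊢ z → x ⊢ z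
    ⊢-trans x⊢y y⊢z = entails (use y⊢z (use x⊢y hyp))

    ⊤∈S : S ⊤
    ⊤∈S = upward (≼-⊤ 𝐊) K∈S

    ⊢-⊤ : ∀ x → x ⊢ ⊤
    ⊢-⊤ x = entails (lift ⊤∈S)

    ⊥-⊢ : ∀ x → ⊥ ⊢ x
    ⊥-⊢ x = entails (ex-falso hyp)

    ⊗-elim : ∀ {Γ x y} (r : Family) → Γ ⊩ ⟨ x ⊗ y ⟩ → Γ ⊩ (⟨ x ⟩ ⟶ ⟨ y ⟩ ⟶ r) ⟶ r
    ⊗-elim r = ⊩-mono (λ c → ⋀-lower _ (r c))

    fst : ∀ {Γ x y} → Γ ⊩ ⟨ x ⊗ y ⟩ → Γ ⊩ ⟨ x ⟩
    fst {x = x} d = app (⊗-elim ⟨ x ⟩ d) (closed K-valid)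

    snd : ∀ {Γ x y} → Γ ⊩ ⟨ x ⊗ y ⟩ → Γ ⊩ ⟨ y ⟩
    snd {y = y} d = app (⊗-elim ⟨ y ⟩ d) (⟶-intro (weaken (closed I-valid)))

    -- introduction: λ x′ y′ k. k x′ y′ is uniform in c, hence generalises
    pairing : ∀ x y → x ⊢ y ⇒ x ⊗ y
    pairing x y = subst S (cong (x ⇒_) (sym (⇒-⋀ y _)))
      (generalise (⟶-intro (⟶-intro (app (app hyp (weaken (weaken hyp))) (weaken hyp)))))

    pair : ∀ {Γ x y} → Γ ⊩ ⟨ x ⟩ → Γ ⊩ ⟨ y ⟩ → Γ ⊩ ⟨ x ⊗ y ⟩
    pair {x = x} {y} dx dy = app (app (lift (pairing x y)) dx) dy

    ⊗-⊢ˡ : ∀ x y → x ⊗ y ⊢ x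
    ⊗-⊢ˡ x y = entails (fst hyp)

    ⊗-⊢ʳ : ∀ x y → x ⊗ y ⊢ y
    ⊗-⊢ʳ x y = entails (snd hyp)

    ⊢-⊗ : ∀ {x y z} → z ⊢ x → z ⊢ y → z ⊢ x ⊗ y
    ⊢-⊗ z⊢x z⊢y = entails (pair (use z⊢x hyp) (use z⊢y hyp))

    -- Disjunction x ⊕ y = ⋀ c. (x ⇒ c) ⇒ (y ⇒ c) ⇒ c; injections λ f g. f x′
    -- (resp. g y′) generalise, and case analysis instantiates the meet.
    ⊢-⊕ˡ : ∀ x y → x ⊢ x ⊕ y
    ⊢-⊕ˡ x y = generalise (⟶-intro (⟶-intro (app (weaken hyp) (weaken (weaken hyp)))))

    ⊢-⊕ʳ : ∀ x y → y ⊢ x ⊕ y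
    ⊢-⊕ʳ x y = generalise (⟶-intro (⟶-intro (app hyp (weaken (weaken hyp)))))

    case : ∀ {Γ x y z} → Γ ⊩ ⟨ x ⊕ y ⟩ → Γ ⊩ ⟨ x ⟩ ⟶ ⟨ z ⟩ → Γ ⊩ ⟨ y ⟩ ⟶ ⟨ z ⟩ → Γ ⊩ ⟨ z ⟩
    case {z = z} d f g = app (app (⊩-mono (λ c → ⋀-lower _ z) d) f) g

    ⊕-⊢ : ∀ {x y z} → x ⊢ z → y ⊢ z → x ⊕ y ⊢ z
    ⊕-⊢ x⊢z y⊢z = entails (case hyp (lift x⊢z) (lift y⊢z))

    curry : ∀ {w x y} → w ⊗ x ⊢ y → w ⊢ x ⇒ y
    curry w⊗x⊢y = entails (⟶-intro (use w⊗x⊢y (pair (weaken hyp) hyp)))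

    uncurry : ∀ {w x y} → w ⊢ x ⇒ y → w ⊗ x ⊢ y
    uncurry w⊢x⇒y = entails (app (use w⊢x⇒y (fst hyp)) (snd hyp))

    ¬⊕⊢⇒ : ∀ x y → ¬′ x ⊕ y ⊢ x ⇒ y
    ¬⊕⊢⇒ x y = entails (⟶-intro
      (case (weaken hyp) (⟶-intro (ex-falso (app hyp (weaken hyp)))) (closed I-valid)))

    peirce : IsClassical S → ∀ {Γ a x} → Γ ⊩ ((a ⟶ ⟨ x ⟩) ⟶ a) ⟶ a
    peirce cc∈S {a = a} {x} = ⊩-mono (λ c → ⋀-lower _ (a c , x)) (lift cc∈S)

    -- Classically x ⇒ y entails ¬x ⊕ y: given h : x ⇒ y, f : ¬x ⇒ c and
    -- g : y ⇒ c, Peirce's law reduces the goal c to  f (λ x′. k (g (h x′)))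
    -- under a hypothesis k : c ⇒ ⊥.
    ⇒⊢¬⊕ : IsClassical S → ∀ x y → x ⇒ y ⊢ ¬′ x ⊕ y
    ⇒⊢¬⊕ cc∈S x y = generalise (⟶-intro (⟶-intro
      (app (peirce cc∈S) (⟶-intro (app f (⟶-intro (app k (app g (app h hyp)))))))))
      where
      Γ : Context
      Γ = ε ,, ⟨ x ⇒ y ⟩ ,, (⟨ ¬′ x ⟩ ⟶ ι) ,, (⟨ y ⟩ ⟶ ι) ,, (ι ⟶ ⟨ ⊥ ⟩)
      k : Γ ,, ⟨ x ⟩ ⊩ ι ⟶ ⟨ ⊥ ⟩
      k = weaken hyp
      g : Γ ,, ⟨ x ⟩ ⊩ ⟨ y ⟩ ⟶ ι
      g = weaken (weaken hyp)
      f : Γ ⊩ ⟨ ¬′ x ⟩ ⟶ ι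
      f = weaken (weaken hyp)
      h : Γ ,, ⟨ x ⟩ ⊩ ⟨ x ⇒ y ⟩
      h = weaken (weaken (weaken (weaken hyp)))

    -- The poset reflection: ⊣⊢ is the equivalence induced by the preorder ⊢.
    ⊢-isPartialOrder : IsPartialOrder _⊣⊢_ _⊢_
    ⊢-isPartialOrder = record
      { isPreorder = record
        { isEquivalence = record
          { refl = ⊢-refl , ⊢-refl
          ; sym = λ (x⊢y , y⊢x) → y⊢x , x⊢y
          ; trans = λ (x⊢y , y⊢x) (y⊢z , z⊢y) → ⊢-trans x⊢y y⊢z , ⊢-trans z⊢y y⊢x }
        ; reflexive = proj₁
        ; trans = ⊢-trans }
      ; antisym = _,_ }

    ⊢-isBoundedLattice : IsBoundedLattice _⊣⊢_ _⊢_ _⊕_ _⊗_ ⊤ ⊥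
    ⊢-isBoundedLattice = record
      { isLattice = record
        { isPartialOrder = ⊢-isPartialOrder
        ; supremum = λ x y → ⊢-⊕ˡ x y , ⊢-⊕ʳ x y , λ _ → ⊕-⊢
        ; infimum = λ x y → ⊗-⊢ˡ x y , ⊗-⊢ʳ x y , λ _ → ⊢-⊗ }
      ; maximum = ⊢-⊤
      ; minimum = ⊥-⊢ }

    ⊢-isHeytingAlgebra : IsHeytingAlgebra _⊣⊢_ _⊢_ _⊕_ _⊗_ _⇒_ ⊤ ⊥
    ⊢-isHeytingAlgebra = record
      { isBoundedLattice = ⊢-isBoundedLattice
      ; exponential = λ _ _ _ → curry , uncurry }

    -- Classically the exponential x ⇒ y may be replaced by ¬x ⊕ y.
    ⊢-isBooleanAlgebra : IsClassical S → IsBooleanAlgebra _⊣⊢_ _⊢_ _⊕_ _⊗_ ¬′ ⊤ ⊥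
    ⊢-isBooleanAlgebra cc∈S = record { isHeytingAlgebra = record
      { isBoundedLattice = ⊢-isBoundedLattice
      ; exponential = λ _ x y →
          (λ w⊗x⊢y → ⊢-trans (curry w⊗x⊢y) (⇒⊢¬⊕ cc∈S x y)) ,
          (λ w⊢¬x⊕y → uncurry (⊢-trans w⊢¬x⊕y (¬⊕⊢⇒ x y))) } }

    ⊣⊢⊤⇔∈S : ∀ c → (c ⊣⊢ ⊤) ⇔ S c
    ⊣⊢⊤⇔∈S c = mk⇔ (λ (_ , ⊤⊢c) → modusPonens ⊤⊢c ⊤∈S)
                    (λ c∈S → ⊢-⊤ c , entails (lift c∈S))

    -- The class of ⊥ consists of the c with ¬c ∈ S (c ⊢ ⊥ is literally ¬c ∈ S).
    ⊣⊢⊥⇔¬∈S : ∀ c → (c ⊣⊢ ⊥) ⇔ S (¬′ c)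
    ⊣⊢⊥⇔¬∈S c = mk⇔ proj₁ (λ c⊢⊥ → c⊢⊥ , ⊥-⊢ c)

proposition3p21 : {ℓa ℓr s : Level} (𝒜 : ImplicativeStructure ℓa ℓr)
    → let open ImplicativeStructure 𝒜 in
      let open ImplicativeStructureOps 𝒜 in
      (S : Carrier → Set s) → IsSeparator S
    → let open Entailment S in
      IsHeytingAlgebra _⊣⊢_ _⊢_ _⊕_ _⊗_ _⇒_ ⊤ ⊥
      × (∀ c → (c ⊣⊢ ⊤) ⇔ S c)
      × (∀ c → (c ⊣⊢ ⊥) ⇔ S (¬′ c))
      × (IsClassical S → IsBooleanAlgebra _⊣⊢_ _⊢_ _⊕_ _⊗_ ¬′ ⊤ ⊥)
proposition3p21 𝒜 S sep = ⊢-isHeytingAlgebra , ⊣⊢⊤⇔∈S , ⊣⊢⊥⇔¬∈S , ⊢-isBooleanAlgebra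
  where open ImplicativeLogic.SeparatorLogic 𝒜 S sep
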